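{- Let $L=\langle R_i:i\in I\rangle$ be a relational language with $\operatorname{ar}(R_i)=n_i\in\mathbb N$, let $X\neq\emptyset$, and let $\mathcal C\subseteq \operatorname{Int}_L(X)$ be an isomorphism-invariant set. Let $\tau\in\operatorname{Max}\mathcal C$ (respectively, $\tau\in\operatorname{Min}\mathcal C$). Then: (a) $\tau$ is a reversible interpretation; (b) $[\tau]_{\cong}=[\tau]_{\sim_c}$, this set is an antichain in $\langle\mathcal C,\subseteq\rangle$, and $[\tau]_{\cong}\subseteq\operatorname{Max}\mathcal C$ (respectively, $[\tau]_{\cong}\subseteq\operatorname{Min}\mathcal C$); (c) the set $\mathcal C^c=\{\rho^c:\rho\in\mathcal C\}$ is isomorphism-invariant, and for every $\tau\in\operatorname{Int}_L(X)$ we have $\tau\in\operatorname{Max}\mathcal C$ iff $\tau^c\in\operatorname{Min}(\mathcal C^c)$.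
   Context: $\operatorname{Int}_L(X)=\prod_{i\in I}P(X^{n_i})$ is the set of all interpretations $\rho=\langle\rho_i:i\in I\rangle$ of $L$ on $X$. For $\rho,\sigma\in\operatorname{Int}_L(X)$ write $\rho\subseteq\sigma$ iff $\rho_i\subseteq\sigma_i$ for all $i$; $\rho^c=\langle X^{n_i}\setminus\rho_i:i\in I\rangle$. $\operatorname{Max}\mathcal C$, $\operatorname{Min}\mathcal C$ denote the maximal, minimal elements of $\langle\mathcal C,\subseteq\rangle$. Write $\rho\cong\sigma$ iff the structures $\langle X,\rho\rangle$ and $\langle X,\sigma\rangle$ are isomorphic, and $[\rho]_\cong=\{\sigma\in\operatorname{Int}_L(X):\sigma\cong\rho\}$. A set $\mathcal C$ is isomorphism-invariant iff $[\rho]_\cong\subseteq\mathcal C$ for all $\rho\in\mathcal C$. A condensation is a bijective homomorphism; $\rho\preccurlyeq_c\sigma$ iff there is a condensation $\langle X,\rho\rangle\to\langle X,\sigma\rangle$; $\rho\sim_c\sigma$ iff $\rho\preccurlyeq_c\sigma$ and $\sigma\preccurlyeq_c\rho$; $[\rho]_{\sim_c}=\{\sigma:\sigma\sim_c\rho\}$. An interpretation $\rho$ is reversible iff every condensation of $\langle X,\rho\rangle$ onto itself is an automorphism. -}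

module Defs where

open import Data.Nat using (ℕ)
open import Data.Bool using (Bool; true; false; not)
open import Data.Vec using (Vec; map)
open import Data.Product using (Σ; ∃; _×_; _,_)
open import Function.Bundles using (_⤖_; Bijection)
open import Relation.Binary.PropositionalEquality using (_≡_)

-- Subsets of X^{n_i} are represented classically as
-- characteristic functions Vec X (n i) → Bool (so P(X^{n_i}) is a genuine
-- Boolean power set and complements are involutive).

module _ {I : Set} (n : I → ℕ) (X : Set) where

  Int : Set
  Int = (i : I) → Vec X (n i) → Bool

  _⊆ᵢ_ : Int → Int → Set
  ρ ⊆ᵢ σ = ∀ i (v : Vec X (n i)) → ρ i v ≡ true → σ i v ≡ true

  _≐_ : Int → Int → Set
  ρ ≐ σ = ∀ i (v : Vec X (n i)) → ρ i v ≡ σ i v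

  compl : Int → Int
  compl ρ i v = not (ρ i v)

  Family : Set₁
  Family = Int → Set

  _≅_ : Int → Int → Set
  ρ ≅ σ = Σ (X ⤖ X) λ f → ∀ i (v : Vec X (n i)) →
            ρ i v ≡ σ i (map (Bijection.to f) v)

  _≼c_ : Int → Int → Set
  ρ ≼c σ = Σ (X ⤖ X) λ f → ∀ i (v : Vec X (n i)) →
             ρ i v ≡ true → σ i (map (Bijection.to f) v) ≡ true

  _∼c_ : Int → Int → Set
  ρ ∼c σ = (ρ ≼c σ) × (σ ≼c ρ)

  IsAutomorphism : Int → (X ⤖ X) → Set
  IsAutomorphism ρ f = ∀ i (v : Vec X (n i)) → ρ i v ≡ ρ i (map (Bijection.to f) v)

  IsSelfCondensation : Int → (X ⤖ X) → Set
  IsSelfCondensation ρ f = ∀ i (v : Vec X (n i)) →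
                             ρ i v ≡ true → ρ i (map (Bijection.to f) v) ≡ true

  Reversible : Int → Set
  Reversible ρ = (f : X ⤖ X) → IsSelfCondensation ρ f → IsAutomorphism ρ f

  IsoInvariant : Family → Set
  IsoInvariant C = ∀ ρ σ → ρ ≅ σ → C ρ → C σ

  IsMax : Family → Int → Set
  IsMax C τ = C τ × (∀ σ → C σ → τ ⊆ᵢ σ → σ ⊆ᵢ τ)

  IsMin : Family → Int → Set
  IsMin C τ = C τ × (∀ σ → C σ → σ ⊆ᵢ τ → τ ⊆ᵢ σ)

  Antichain : Family → Family → Set
  Antichain C S = (∀ σ → S σ → C σ) ×
                  (∀ σ σ' → S σ → S σ' → σ ⊆ᵢ σ' → σ' ⊆ᵢ σ)

  ComplFamily : Family → Family
  ComplFamily C σ = ∃ λ ρ → C ρ × (σ ≐ compl ρ)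

  IsoClass : Int → Family
  IsoClass τ σ = σ ≅ τ

  CondClass : Int → Family
  CondClass τ σ = σ ∼c τ

module Submission where

-- Everything is phrased via the pullback  (h ⋆ ρ)_i(v) = ρ_i(h v)  along
-- h : X → X.  By definition σ ≅ τ via f means σ ≐ f ⋆ τ, a self-condensation
-- f of τ means τ ⊆ f ⋆ τ, and an automorphism means τ ≐ f ⋆ τ.  Pullback is
-- monotone and, for a bijection f with inverse g, obeys the shifts
-- ρ ⊆ f ⋆ σ ⇒ g ⋆ ρ ⊆ σ  and  f ⋆ ρ ⊆ σ ⇒ ρ ⊆ g ⋆ σ.  As C is closed under
-- pullback along bijections, comparing τ with f ⋆ τ (or a competitor ρ with
-- g ⋆ ρ) inside C yields reversibility (a) and the isomorphism invariance of
-- maximality/minimality (b); reversibility alone makes ≅ and ∼c agree.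
-- Part (c) uses that complementation is an antitone involution commuting
-- with pullback.

open import Defs
open import Data.Nat using (ℕ)
open import Data.Bool using (Bool; true; false; not)
open import Data.Bool.Properties using (not-involutive; not-injective)
open import Data.Product using (_×_; _,_; proj₁; proj₂)
open import Data.Vec using (Vec; map)
open import Data.Vec.Properties using (map-∘; map-cong; map-id)
open import Function using (_∘_)
open import Function.Bundles using (_⤖_; Bijection; Surjection)
open import Function.Properties.Bijection using (sym-≡)
open import Function.Construct.Identity using (⤖-id)
open import Function.Construct.Composition using (_⤖-∘_)
open import Relation.Binary.PropositionalEquality
  using (_≡_; refl; sym; trans; cong)

true-iff⇒≡ : {a b : Bool} → (a ≡ true → b ≡ true) → (b ≡ true → a ≡ true) → a ≡ b
true-iff⇒≡ {false} {false} _ _ = refl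
true-iff⇒≡ {false} {true}  _ b⇒a = b⇒a refl
true-iff⇒≡ {true}  {_}     a⇒b _ = sym (a⇒b refl)

not-antitone : {a b : Bool} → (a ≡ true → b ≡ true) → not b ≡ true → not a ≡ true
not-antitone {false} _ _ = refl
not-antitone {true} {false} a⇒b _ = a⇒b refl
not-antitone {true} {true} _ ()

module Interpretations {I : Set} (n : I → ℕ) (X : Set) where

  Interp : Set
  Interp = Int n X

  infix 4 _⊆_ _≈_
  infixr 9 _⋆_

  _⊆_ : Interp → Interp → Set
  _⊆_ = _⊆ᵢ_ n X

  _≈_ : Interp → Interp → Set
  _≈_ = _≐_ n X

  _⋆_ : (X → X) → Interp → Interp
  (h ⋆ ρ) i v = ρ i (map h v)

  ≈-refl : {ρ : Interp} → ρ ≈ ρ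
  ≈-refl _ _ = refl

  ≈-sym : {ρ σ : Interp} → ρ ≈ σ → σ ≈ ρ
  ≈-sym e i v = sym (e i v)

  ≈-trans : {ρ σ θ : Interp} → ρ ≈ σ → σ ≈ θ → ρ ≈ θ
  ≈-trans e e' i v = trans (e i v) (e' i v)

  ≈⇒⊆ : {ρ σ : Interp} → ρ ≈ σ → ρ ⊆ σ
  ≈⇒⊆ e i v ρv = trans (sym (e i v)) ρv

  ⊆-trans : {ρ σ θ : Interp} → ρ ⊆ σ → σ ⊆ θ → ρ ⊆ θ
  ⊆-trans ρ⊆σ σ⊆θ i v = σ⊆θ i v ∘ ρ⊆σ i v

  ⊆-antisym : {ρ σ : Interp} → ρ ⊆ σ → σ ⊆ ρ → ρ ≈ σ
  ⊆-antisym ρ⊆σ σ⊆ρ i v = true-iff⇒≡ (ρ⊆σ i v) (σ⊆ρ i v)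

  ⋆-mono : {ρ σ : Interp} (h : X → X) → ρ ⊆ σ → h ⋆ ρ ⊆ h ⋆ σ
  ⋆-mono h ρ⊆σ i v = ρ⊆σ i (map h v)

  ⋆-∘ : (h k : X → X) (ρ : Interp) → k ⋆ h ⋆ ρ ≈ (h ∘ k) ⋆ ρ
  ⋆-∘ h k ρ i v = cong (ρ i) (sym (map-∘ h k v))

  ⋆-cancel : {h k : X → X} → (∀ x → h (k x) ≡ x) → (ρ : Interp) → k ⋆ h ⋆ ρ ≈ ρ
  ⋆-cancel {h} {k} hk ρ i v = cong (ρ i) (map-section v)
    where
    map-section : ∀ {m} (w : Vec X m) → map h (map k w) ≡ w
    map-section w = trans (sym (map-∘ h k w)) (trans (map-cong hk w) (map-id w))

  shiftˡ : {h k : X → X} → (∀ x → h (k x) ≡ x) →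
           {ρ σ : Interp} → ρ ⊆ h ⋆ σ → k ⋆ ρ ⊆ σ
  shiftˡ {h} {k} hk {σ = σ} ρ⊆hσ = ⊆-trans (⋆-mono k ρ⊆hσ) (≈⇒⊆ (⋆-cancel hk σ))

  shiftʳ : {h k : X → X} → (∀ x → h (k x) ≡ x) →
           {ρ σ : Interp} → h ⋆ ρ ⊆ σ → ρ ⊆ k ⋆ σ
  shiftʳ {h} {k} hk {ρ} hρ⊆σ = ⊆-trans (≈⇒⊆ (≈-sym (⋆-cancel hk ρ))) (⋆-mono k hρ⊆σ)

  ⋆-reflects : {h k : X → X} → (∀ x → h (k x) ≡ x) →
               {ρ σ : Interp} → h ⋆ ρ ⊆ h ⋆ σ → ρ ⊆ σ
  ⋆-reflects hk {σ = σ} hρ⊆hσ = ⊆-trans (shiftʳ hk hρ⊆hσ) (≈⇒⊆ (⋆-cancel hk σ))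

  to : X ⤖ X → X → X
  to = Bijection.to

  inverse : X ⤖ X → X ⤖ X
  inverse = sym-≡

  to-inverse : (f : X ⤖ X) → ∀ x → to f (to (inverse f) x) ≡ x
  to-inverse f = Surjection.to∘to⁻ (Bijection.surjection f)

  inverse-to : (f : X ⤖ X) → ∀ x → to (inverse f) (to f x) ≡ x
  inverse-to f x = Bijection.injective f (to-inverse f (to f x))

  iso⇒cond : {σ τ : Interp} → _≅_ n X σ τ → _∼c_ n X σ τ
  iso⇒cond (f , σ≈fτ) =
    (f , ≈⇒⊆ σ≈fτ) , (inverse f , shiftʳ (to-inverse f) (≈⇒⊆ (≈-sym σ≈fτ)))

  -- For a reversible τ, mutual condensations are isomorphisms: composing
  -- them gives a self-condensation of τ, hence an automorphism, which forces
  -- the condensation σ → τ to be onto the relations of τ.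
  cond⇒iso : {σ τ : Interp} → Reversible n X τ → _∼c_ n X σ τ → _≅_ n X σ τ
  cond⇒iso {σ} {τ} rev ((f , σ⊆fτ) , (g , τ⊆gσ)) = f , ⊆-antisym σ⊆fτ fτ⊆σ
    where
    τ⊆gfτ : τ ⊆ to g ⋆ to f ⋆ τ
    τ⊆gfτ = ⊆-trans τ⊆gσ (⋆-mono (to g) σ⊆fτ)

    automorphism : τ ≈ (to f ∘ to g) ⋆ τ
    automorphism = rev (f ⤖-∘ g) (⊆-trans τ⊆gfτ (≈⇒⊆ (⋆-∘ (to f) (to g) τ)))

    gfτ⊆gσ : to g ⋆ to f ⋆ τ ⊆ to g ⋆ σ
    gfτ⊆gσ = ⊆-trans (≈⇒⊆ (≈-trans (⋆-∘ (to f) (to g) τ) (≈-sym automorphism))) τ⊆gσ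

    fτ⊆σ : to f ⋆ τ ⊆ σ
    fτ⊆σ = ⋆-reflects (to-inverse g) gfτ⊆gσ

  reversible-classes : {τ : Interp} → Reversible n X τ → ∀ σ →
    (IsoClass n X τ σ → CondClass n X τ σ) × (CondClass n X τ σ → IsoClass n X τ σ)
  reversible-classes rev σ = iso⇒cond , cond⇒iso rev

  maxima-antichain : {C S : Family n X} → (∀ σ → S σ → IsMax n X C σ) → Antichain n X C S
  maxima-antichain maximal =
    (λ σ Sσ → proj₁ (maximal σ Sσ)) ,
    (λ σ σ' Sσ Sσ' → proj₂ (maximal σ Sσ) σ' (proj₁ (maximal σ' Sσ')))

  minima-antichain : {C S : Family n X} → (∀ σ → S σ → IsMin n X C σ) → Antichain n X C S
  minima-antichain minimal =
    (λ σ Sσ → proj₁ (minimal σ Sσ)) ,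
    (λ σ σ' Sσ Sσ' → proj₂ (minimal σ' Sσ') σ (proj₁ (minimal σ Sσ)))

  ᶜ : Interp → Interp
  ᶜ = compl n X

  ᶜ-involutive : (ρ : Interp) → ᶜ (ᶜ ρ) ≈ ρ
  ᶜ-involutive ρ i v = not-involutive (ρ i v)

  ᶜ-cong : {ρ σ : Interp} → ρ ≈ σ → ᶜ ρ ≈ ᶜ σ
  ᶜ-cong e i v = cong not (e i v)

  ᶜ-injective : {ρ σ : Interp} → ᶜ ρ ≈ ᶜ σ → ρ ≈ σ
  ᶜ-injective e i v = not-injective (e i v)

  ᶜ-antitone : {ρ σ : Interp} → ρ ⊆ σ → ᶜ σ ⊆ ᶜ ρ
  ᶜ-antitone ρ⊆σ i v = not-antitone (ρ⊆σ i v)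

  ᶜ-reflects : {ρ σ : Interp} → ᶜ ρ ⊆ ᶜ σ → σ ⊆ ρ
  ᶜ-reflects {ρ} {σ} ρᶜ⊆σᶜ =
    ⊆-trans (≈⇒⊆ (≈-sym (ᶜ-involutive σ))) (⊆-trans (ᶜ-antitone ρᶜ⊆σᶜ) (≈⇒⊆ (ᶜ-involutive ρ)))

  module _ {C : Family n X} (C-inv : IsoInvariant n X C) where

    closed-≈ : {ρ σ : Interp} → ρ ≈ σ → C ρ → C σ
    closed-≈ {ρ} {σ} ρ≈σ = C-inv ρ σ (⤖-id X , λ i v → trans (ρ≈σ i v) (cong (σ i) (sym (map-id v))))

    closed-⋆ : {ρ : Interp} (f : X ⤖ X) → C ρ → C (to f ⋆ ρ)
    closed-⋆ {ρ} f = C-inv ρ (to f ⋆ ρ) (inverse f , ≈-sym (⋆-cancel (to-inverse f) ρ))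

    -- Part (a): maxima and minima are reversible.  A self-condensation f of
    -- τ gives τ ⊆ f ⋆ τ (resp. g ⋆ τ ⊆ τ for g = f⁻¹) inside C.
    max-reversible : {τ : Interp} → IsMax n X C τ → Reversible n X τ
    max-reversible (Cτ , maxτ) f τ⊆fτ = ⊆-antisym τ⊆fτ (maxτ _ (closed-⋆ f Cτ) τ⊆fτ)

    min-reversible : {τ : Interp} → IsMin n X C τ → Reversible n X τ
    min-reversible {τ} (Cτ , minτ) f τ⊆fτ = ⊆-antisym τ⊆fτ fτ⊆τ
      where
      τ⊆gτ : τ ⊆ to (inverse f) ⋆ τ
      τ⊆gτ = minτ _ (closed-⋆ (inverse f) Cτ) (shiftˡ (to-inverse f) τ⊆fτ)

      fτ⊆τ : to f ⋆ τ ⊆ τ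
      fτ⊆τ = shiftˡ (inverse-to f) τ⊆gτ

    -- Part (b), last claim: maximality and minimality are invariant under
    -- isomorphism; a competitor ρ of σ ≐ f ⋆ τ is transported to g ⋆ ρ.
    max-iso : {σ τ : Interp} → IsMax n X C τ → _≅_ n X σ τ → IsMax n X C σ
    max-iso {σ} {τ} (Cτ , maxτ) (f , σ≈fτ) =
      closed-≈ (≈-sym σ≈fτ) (closed-⋆ f Cτ) , below
      where
      below : ∀ ρ → C ρ → σ ⊆ ρ → ρ ⊆ σ
      below ρ Cρ σ⊆ρ = ⊆-trans (shiftʳ (inverse-to f) gρ⊆τ) (≈⇒⊆ (≈-sym σ≈fτ))
        where
        τ⊆gρ : τ ⊆ to (inverse f) ⋆ ρ
        τ⊆gρ = shiftʳ (to-inverse f) (⊆-trans (≈⇒⊆ (≈-sym σ≈fτ)) σ⊆ρ)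

        gρ⊆τ : to (inverse f) ⋆ ρ ⊆ τ
        gρ⊆τ = maxτ _ (closed-⋆ (inverse f) Cρ) τ⊆gρ

    min-iso : {σ τ : Interp} → IsMin n X C τ → _≅_ n X σ τ → IsMin n X C σ
    min-iso {σ} {τ} (Cτ , minτ) (f , σ≈fτ) =
      closed-≈ (≈-sym σ≈fτ) (closed-⋆ f Cτ) , above
      where
      above : ∀ ρ → C ρ → ρ ⊆ σ → σ ⊆ ρ
      above ρ Cρ ρ⊆σ = ⊆-trans (≈⇒⊆ σ≈fτ) (shiftˡ (inverse-to f) τ⊆gρ)
        where
        gρ⊆τ : to (inverse f) ⋆ ρ ⊆ τ
        gρ⊆τ = shiftˡ (to-inverse f) (⊆-trans ρ⊆σ (≈⇒⊆ σ≈fτ))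

        τ⊆gρ : τ ⊆ to (inverse f) ⋆ ρ
        τ⊆gρ = minτ _ (closed-⋆ (inverse f) Cρ) gρ⊆τ

    compl-invariant : IsoInvariant n X (ComplFamily n X C)
    compl-invariant ρ σ (f , ρ≈fσ) (ρ₀ , Cρ₀ , ρ≈ρ₀ᶜ) =
      ᶜ σ , C-inv ρ₀ (ᶜ σ) (f , ρ₀≈fσᶜ) Cρ₀ , ≈-sym (ᶜ-involutive σ)
      where
      ρ₀≈fσᶜ : ρ₀ ≈ to f ⋆ ᶜ σ
      ρ₀≈fσᶜ = ≈-trans (≈-sym (ᶜ-involutive ρ₀)) (ᶜ-cong (≈-trans (≈-sym ρ≈ρ₀ᶜ) ρ≈fσ))

    max⇒ᶜ-min : {τ : Interp} → IsMax n X C τ → IsMin n X (ComplFamily n X C) (ᶜ τ)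
    max⇒ᶜ-min {τ} (Cτ , maxτ) = (τ , Cτ , ≈-refl) , above
      where
      above : ∀ σ → ComplFamily n X C σ → σ ⊆ ᶜ τ → ᶜ τ ⊆ σ
      above σ (ρ , Cρ , σ≈ρᶜ) σ⊆τᶜ = ⊆-trans (ᶜ-antitone ρ⊆τ) (≈⇒⊆ (≈-sym σ≈ρᶜ))
        where
        ρ⊆τ : ρ ⊆ τ
        ρ⊆τ = maxτ ρ Cρ (ᶜ-reflects (⊆-trans (≈⇒⊆ (≈-sym σ≈ρᶜ)) σ⊆τᶜ))

    ᶜ-min⇒max : {τ : Interp} → IsMin n X (ComplFamily n X C) (ᶜ τ) → IsMax n X C τ
    ᶜ-min⇒max {τ} ((ρ , Cρ , τᶜ≈ρᶜ) , minτᶜ) =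
      closed-≈ (≈-sym (ᶜ-injective τᶜ≈ρᶜ)) Cρ ,
      λ σ Cσ τ⊆σ → ᶜ-reflects (minτᶜ (ᶜ σ) (σ , Cσ , ≈-refl) (ᶜ-antitone τ⊆σ))

theorem3p1 : {I : Set} (n : I → ℕ) (X : Set) → X →
    (C : Family n X) → IsoInvariant n X C →
    (∀ τ → IsMax n X C τ →
       Reversible n X τ
       × (∀ σ → (IsoClass n X τ σ → CondClass n X τ σ) × (CondClass n X τ σ → IsoClass n X τ σ))
       × Antichain n X C (IsoClass n X τ)
       × (∀ σ → IsoClass n X τ σ → IsMax n X C σ))
    × (∀ τ → IsMin n X C τ →
       Reversible n X τ
       × (∀ σ → (IsoClass n X τ σ → CondClass n X τ σ) × (CondClass n X τ σ → IsoClass n X τ σ))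
       × Antichain n X C (IsoClass n X τ)
       × (∀ σ → IsoClass n X τ σ → IsMin n X C σ))
    × IsoInvariant n X (ComplFamily n X C)
    × (∀ τ → (IsMax n X C τ → IsMin n X (ComplFamily n X C) (compl n X τ))
           × (IsMin n X (ComplFamily n X C) (compl n X τ) → IsMax n X C τ))
theorem3p1 n X _ C C-inv =
    (λ τ τ-max → max-reversible C-inv τ-max , reversible-classes (max-reversible C-inv τ-max) ,
                 maxima-antichain (λ σ → max-iso C-inv τ-max) , (λ σ → max-iso C-inv τ-max))
  , (λ τ τ-min → min-reversible C-inv τ-min , reversible-classes (min-reversible C-inv τ-min) ,
                 minima-antichain (λ σ → min-iso C-inv τ-min) , (λ σ → min-iso C-inv τ-min))
  , compl-invariant C-inv
  , (λ τ → max⇒ᶜ-min C-inv , ᶜ-min⇒max C-inv)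
  where open Interpretations n X
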